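{- For every positive integer $n$, $R_n^{B,+}(t)=R_n^{D}(t)$ and $R_n^{B,- }(t)=R_n^{B-D}(t)$.
   Context: $\mathfrak{B}_n$ is the group of signed permutations in window notation $\pi=\pi_1\cdots\pi_n$, with $\mathrm{inv}_B(\pi)=|\{i<j:\pi_i>\pi_j\}|+|\{i<j:-\pi_i>\pi_j\}|+|\{i:\pi_i<0\}|$; $\mathfrak{B}_n^+$ is the set of $\pi$ with $\mathrm{inv}_B(\pi)$ even and $\mathfrak{B}_n^-=\mathfrak{B}_n\setminus\mathfrak{B}_n^+$; $\mathfrak{D}_n$ is the set of $\pi\in\mathfrak{B}_n$ with an even number of negative entries. Set $\pi_0=0$; $\mathrm{pk}_B(\pi)$ (resp. $\mathrm{val}_B(\pi)$) is the number of $i\in\{1,\dots,n-1\}$ with $\pi_{i-1}<\pi_i>\pi_{i+1}$ (resp. $\pi_{i-1}>\pi_i<\pi_{i+1}$), and $\mathrm{altruns}_B(\pi)=\mathrm{pk}_B(\pi)+\mathrm{val}_B(\pi)+1$. For a subset $X\subseteq\mathfrak{B}_n$ write $\sum_{\pi\in X}t^{\mathrm{altruns}_B(\pi)}$; then $R_n^{B,\pm}$ is this sum over $\mathfrak{B}_n^{\pm}$, $R_n^D$ over $\mathfrak{D}_n$, and $R_n^{B-D}$ over $\mathfrak{B}_n\setminus\mathfrak{D}_n$. -}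

module Defs where

open import Data.Nat as ℕ using (ℕ; zero; suc)
open import Data.Integer as ℤ using (ℤ; +_; -_; ∣_∣; _<?_)
open import Data.List using (List; []; _∷_; length; filter; map; concatMap; upTo)
open import Data.List.Relation.Unary.Unique.Propositional using (Unique)
open import Data.List.Relation.Unary.Unique.DecPropositional ℕ._≟_ using (unique?)
open import Data.List.Relation.Unary.All using (All)
open import Data.Bool using (Bool; true; false; if_then_else_)
open import Relation.Nullary.Decidable using (does; _×-dec_)
open import Data.Product using (_×_)
open import Relation.Binary.PropositionalEquality using (_≡_)

countB : {A : Set} → (A → Bool) → List A → ℕ
countB p []       = 0
countB p (x ∷ xs) = (if p x then 1 else 0) ℕ.+ countB p xs

signedEntries : ℕ → List ℤ
signedEntries n = concatMap (λ i → (+ suc i) ∷ (- (+ suc i)) ∷ []) (upTo n)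

words : {A : Set} → List A → ℕ → List (List A)
words L zero    = [] ∷ []
words L (suc k) = concatMap (λ x → map (x ∷_) (words L k)) L

-- the group 𝔅_n in window notation: words of length n over ±[n] whose
-- absolute values are pairwise distinct (hence a permutation of [n])
B : ℕ → List (List ℤ)
B n = filter (λ π → unique? (map ∣_∣ π)) (words (signedEntries n) n)

ltB : ℤ → ℤ → Bool
ltB x y = does (x <? y)

neg : List ℤ → ℕ
neg π = countB (λ x → ltB x (+ 0)) π

invB : List ℤ → ℕ
invB []       = 0
invB (x ∷ xs) = countB (λ y → ltB y x) xs
              ℕ.+ countB (λ y → ltB y (- x)) xs
              ℕ.+ (if ltB x (+ 0) then 1 else 0)
              ℕ.+ invB xs

isEven : ℕ → Bool
isEven zero          = true
isEven (suc zero)    = false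
isEven (suc (suc k)) = isEven k

pkSeq : List ℤ → ℕ
pkSeq (a ∷ b ∷ c ∷ rest) =
  (if ltB a b then (if ltB c b then 1 else 0) else 0) ℕ.+ pkSeq (b ∷ c ∷ rest)
pkSeq _ = 0

valSeq : List ℤ → ℕ
valSeq (a ∷ b ∷ c ∷ rest) =
  (if ltB b a then (if ltB b c then 1 else 0) else 0) ℕ.+ valSeq (b ∷ c ∷ rest)
valSeq _ = 0

-- with π₀ = 0: interior positions of 0 π₁ … πₙ are exactly i = 1, …, n-1
pkB : List ℤ → ℕ
pkB π = pkSeq (+ 0 ∷ π)

valB : List ℤ → ℕ
valB π = valSeq (+ 0 ∷ π)

altrunsB : List ℤ → ℕ
altrunsB π = pkB π ℕ.+ valB π ℕ.+ 1

Bplus Bminus D BminusD : ℕ → List (List ℤ)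
Bplus   n = filter (λ π → isEven (invB π) Data.Bool.≟ true) (B n)
Bminus  n = filter (λ π → isEven (invB π) Data.Bool.≟ false) (B n)
D       n = filter (λ π → isEven (neg π) Data.Bool.≟ true) (B n)
BminusD n = filter (λ π → isEven (neg π) Data.Bool.≟ false) (B n)

-- coefficient of t^k in  Σ_{π ∈ X} t^{altruns_B(π)}
coeffR : List (List ℤ) → ℕ → ℕ
coeffR X k = countB (λ π → does (altrunsB π ℕ.≟ k)) X

module Submission where

-- Call π abs-increasing when |π₁| < ⋯ < |πₙ|. Then every pair i < j contributes
-- [πᵢ > πⱼ] + [-πᵢ > πⱼ] = 2·[πⱼ < 0] to inv_B, so inv_B(π) and neg(π) have the same parity.
-- Otherwise let πᵢ be the first entry exceeding a later one in absolute value, and let ι negate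
-- the entry after πᵢ of least absolute value. Both its neighbours have larger absolute values,
-- so every comparison of adjacent entries of 0 π₁ ⋯ πₙ is unchanged and altruns_B is preserved.
-- Negating an entry keeps the parity of the contribution of every pair of entries with distinct
-- absolute values, so ι changes the parities of neg and of inv_B alike. Letting ι act only where
-- these two parities differ gives an involution of 𝔅ₙ that exchanges them and preserves altruns_B.

open import Defs
open import Data.Bool.Base using (Bool; true; false; not; _∧_; _xor_; if_then_else_)
open import Data.Bool.Properties as Bool
  using (¬-not; not-injective; not-involutive; not-distribʳ-xor; not-distribˡ-xor)
open import Data.Integer.Base using (ℤ; +_; -[1+_]; -_; ∣_∣)
open import Data.Integer.Properties using (neg-involutive; ∣-i∣≡∣i∣)
open import Data.List.Base using (List; []; _∷_; _++_; map; filter; concatMap; cartesianProductWith; upTo)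
open import Data.List.Extrema.Nat using (min; argmin-sel; min≤⊤; min≤xs)
open import Data.List.Membership.Propositional using (_∈_; find)
open import Data.List.Membership.Propositional.Properties
  using (∈-map⁺; ∈-map⁻; ∈-filter⁺; ∈-filter⁻; ∈-concatMap⁺; ∈-concatMap⁻; ∈-cartesianProductWith⁺; ∈-cartesianProductWith⁻)
open import Data.List.Membership.Propositional.Properties.WithK using (unique∧set⇒bag)
open import Data.List.Properties using (∷-injective)
open import Data.List.Relation.Binary.BagAndSetEquality using (∼bag⇒↭)
open import Data.List.Relation.Binary.Permutation.Propositional using (_↭_)
import Data.List.Relation.Binary.Permutation.Propositional.Properties as ↭
open import Data.List.Relation.Unary.All as All using (All; []; _∷_; all?)
import Data.List.Relation.Unary.All.Properties as All
open import Data.List.Relation.Unary.Any as Any using (here; there)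
open import Data.List.Relation.Binary.Disjoint.Propositional using (Disjoint)
open import Data.List.Relation.Binary.Pointwise as Pointwise using (Pointwise; []; _∷_)
open import Data.List.Relation.Unary.AllPairs as AllPairs using (AllPairs; []; _∷_)
import Data.List.Relation.Unary.AllPairs.Properties as AllPairs
open import Data.List.Relation.Unary.Unique.Propositional using (Unique)
import Data.List.Relation.Unary.Unique.Propositional.Properties as Unique
open import Data.Nat.Base as ℕ using (ℕ; zero; suc; _+_; _<_; _≤_; z≤n; s≤s)
open import Data.Nat.ListAction using (sum)
open import Data.Nat.ListAction.Properties using (sum-↭)
import Data.Nat.Properties as ℕ
open import Algebra.Properties.CommutativeSemigroup ℕ.+-commutativeSemigroup using (interchange)
open import Data.Product.Base using (_×_; _,_; proj₁; proj₂; ∃-syntax)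
open import Data.Sum.Base using (_⊎_; inj₁; inj₂)
open import Function.Base using (_∘_; id)
open import Function.Bundles using (mk⇔)
open import Relation.Binary.PropositionalEquality
  using (_≡_; _≢_; refl; sym; trans; cong; cong₂; subst; subst₂; module ≡-Reasoning)
open import Relation.Nullary.Decidable using (yes; no; does; dec-true; dec-false)
open import Relation.Nullary.Negation using (¬_; contradiction)
open import Level using (Level)
open import Relation.Unary using (Pred; Decidable)
open import Relation.Binary.Definitions using (tri<; tri≈; tri>)

bit : Bool → ℕ
bit b = if b then 1 else 0

countB≡sum : {A : Set} (p : A → Bool) (xs : List A) → countB p xs ≡ sum (map (bit ∘ p) xs)
countB≡sum p []       = refl
countB≡sum p (x ∷ xs) = cong (_+_ (bit (p x))) (countB≡sum p xs)

countB-↭ : {A : Set} (p : A → Bool) {xs ys : List A} → xs ↭ ys → countB p xs ≡ countB p ys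
countB-↭ p {xs} {ys} xs↭ys = begin
  countB p xs               ≡⟨ countB≡sum p xs ⟩
  sum (map (bit ∘ p) xs)    ≡⟨ sum-↭ (↭.map⁺ (bit ∘ p) xs↭ys) ⟩
  sum (map (bit ∘ p) ys)    ≡⟨ countB≡sum p ys ⟨
  countB p ys               ∎
  where open ≡-Reasoning

countB-map : {A B : Set} (p : B → Bool) (f : A → B) (xs : List A) → countB p (map f xs) ≡ countB (p ∘ f) xs
countB-map p f []       = refl
countB-map p f (x ∷ xs) = cong (_+_ (bit (p (f x)))) (countB-map p f xs)

countB-cong : {A : Set} {p q : A → Bool} (xs : List A) → (∀ {x} → x ∈ xs → p x ≡ q x) → countB p xs ≡ countB q xs
countB-cong []       _   = refl
countB-cong (x ∷ xs) p≗q = cong₂ _+_ (cong bit (p≗q (here refl))) (countB-cong xs (p≗q ∘ there))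

countB-filter : {A : Set} {ℓ : Level} {P : Pred A ℓ} (P? : Decidable P) (p : A → Bool) (xs : List A) →
                countB p (filter P? xs) ≡ countB (λ x → does (P? x) ∧ p x) xs
countB-filter P? p []       = refl
countB-filter P? p (x ∷ xs) with does (P? x)
... | true  = cong (_+_ (bit (p x))) (countB-filter P? p xs)
... | false = countB-filter P? p xs

unique-map⁺ : {A B : Set} {f : A → B} {xs : List A} → (∀ {x y} → x ∈ xs → y ∈ xs → f x ≡ f y → x ≡ y) →
              Unique xs → Unique (map f xs)
unique-map⁺ {xs = []}     _   []         = []
unique-map⁺ {xs = x ∷ xs} inj (x∉xs ∷ u) =
  All.map⁺ (All.tabulate λ y∈xs fx≡fy → All.lookup x∉xs y∈xs (inj (here refl) (there y∈xs) fx≡fy))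
  ∷ unique-map⁺ (λ x∈ y∈ → inj (there x∈) (there y∈)) u

record InvolutionOn {A : Set} (f : A → A) (L : List A) : Set where
  field
    closed     : ∀ {x} → x ∈ L → f x ∈ L
    involutive : ∀ {x} → x ∈ L → f (f x) ≡ x

module _ {A : Set} {f : A → A} {L : List A} (uniq : Unique L) (inv : InvolutionOn f L) where
  open InvolutionOn inv

  map-involution-↭ : map f L ↭ L
  map-involution-↭ = ∼bag⇒↭ (unique∧set⇒bag (unique-map⁺ injective uniq) uniq (mk⇔ to from))
    where
    injective : ∀ {x y} → x ∈ L → y ∈ L → f x ≡ f y → x ≡ y
    injective x∈ y∈ fx≡fy = trans (sym (involutive x∈)) (trans (cong f fx≡fy) (involutive y∈))
    to : ∀ {z} → z ∈ map f L → z ∈ L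
    to z∈ with ∈-map⁻ f z∈
    ... | _ , y∈ , refl = closed y∈
    from : ∀ {z} → z ∈ L → z ∈ map f L
    from z∈ = subst (_∈ map f L) (involutive z∈) (∈-map⁺ f (closed z∈))

  countB-involution : (p : A → Bool) → countB p L ≡ countB (p ∘ f) L
  countB-involution p = trans (sym (countB-↭ p map-involution-↭)) (countB-map p f L)

-- Restricting f to the elements on which P and Q disagree gives an involution carrying P to Q.
countB-exchange : {A C : Set} {f : A → A} {L : List A} (P Q : A → Bool) (s : A → C) →
  Unique L → InvolutionOn f L → (∀ {x} → x ∈ L → s (f x) ≡ s x) →
  (∀ {x} → x ∈ L → P x ≡ Q x ⊎ (P (f x) ≡ not (P x) × Q (f x) ≡ not (Q x))) →
  (h : Bool → C → Bool) → countB (λ x → h (P x) (s x)) L ≡ countB (λ x → h (Q x) (s x)) L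
countB-exchange {A} {C} {f} {L} P Q s uniq inv s∘f≡s agree-or-flip h =
  trans (countB-involution uniq g-involution _) (countB-cong L λ x∈ → cong₂ h (P∘g≡Q x∈) (s∘g≡s x∈))
  where
  open InvolutionOn inv

  g : A → A
  g x = if does (P x Bool.≟ Q x) then x else f x

  g-fixes : ∀ {x} → P x ≡ Q x → g x ≡ x
  g-fixes {x} e = cong (if_then x else f x) (dec-true (P x Bool.≟ Q x) e)

  g-moves : ∀ {x} → P x ≢ Q x → g x ≡ f x
  g-moves {x} ne = cong (if_then x else f x) (dec-false (P x Bool.≟ Q x) ne)

  flips : ∀ {x} → x ∈ L → P x ≢ Q x → P (f x) ≡ not (P x) × Q (f x) ≡ not (Q x)
  flips x∈ ne with agree-or-flip x∈
  ... | inj₁ e    = contradiction e ne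
  ... | inj₂ flip = flip

  P∘g≡Q : ∀ {x} → x ∈ L → P (g x) ≡ Q x
  P∘g≡Q {x} x∈ with P x Bool.≟ Q x
  ... | yes e  = e
  ... | no  ne = trans (proj₁ (flips x∈ ne)) (sym (¬-not (ne ∘ sym)))

  s∘g≡s : ∀ {x} → x ∈ L → s (g x) ≡ s x
  s∘g≡s {x} x∈ with P x Bool.≟ Q x
  ... | yes _  = refl
  ... | no  ne = s∘f≡s x∈

  g-involution : InvolutionOn g L
  g-involution = record { closed = g-closed ; involutive = g-involutive }
    where
    g-closed : ∀ {x} → x ∈ L → g x ∈ L
    g-closed {x} x∈ with P x Bool.≟ Q x
    ... | yes _ = x∈
    ... | no  _ = closed x∈

    g-involutive : ∀ {x} → x ∈ L → g (g x) ≡ x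
    g-involutive {x} x∈ with P x Bool.≟ Q x
    ... | yes e  = g-fixes e
    ... | no  ne = trans (g-moves (ne ∘ not-injective ∘ subst₂ _≡_ P∘f Q∘f)) (involutive x∈)
      where
      P∘f = proj₁ (flips x∈ ne)
      Q∘f = proj₂ (flips x∈ ne)

isEven-suc : ∀ n → isEven (suc n) ≡ not (isEven n)
isEven-suc zero          = refl
isEven-suc (suc zero)    = refl
isEven-suc (suc (suc n)) = isEven-suc n

isEven-+ : ∀ m n → isEven (m + n) ≡ not (isEven m xor isEven n)
isEven-+ zero          n = sym (not-involutive (isEven n))
isEven-+ (suc zero)    n = isEven-suc n
isEven-+ (suc (suc m)) n = isEven-+ m n

isEven-+-congˡ : ∀ m m′ n → isEven m ≡ isEven m′ → isEven (m + n) ≡ isEven (m′ + n)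
isEven-+-congˡ m m′ n e = trans (isEven-+ m n) (trans (cong (λ a → not (a xor isEven n)) e) (sym (isEven-+ m′ n)))

isEven-+-congʳ : ∀ m n n′ → isEven n ≡ isEven n′ → isEven (m + n) ≡ isEven (m + n′)
isEven-+-congʳ m n n′ e = trans (isEven-+ m n) (trans (cong (λ b → not (isEven m xor b)) e) (sym (isEven-+ m n′)))

isEven-+-evenˡ : ∀ m n → isEven m ≡ true → isEven (m + n) ≡ isEven n
isEven-+-evenˡ m n e = trans (isEven-+ m n) (trans (cong (λ a → not (a xor isEven n)) e) (not-involutive (isEven n)))

isEven-+-notˡ : ∀ m m′ n → isEven m′ ≡ not (isEven m) → isEven (m′ + n) ≡ not (isEven (m + n))
isEven-+-notˡ m m′ n e = begin
  isEven (m′ + n)                   ≡⟨ isEven-+ m′ n ⟩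
  not (isEven m′ xor isEven n)      ≡⟨ cong (λ a → not (a xor isEven n)) e ⟩
  not (not (isEven m) xor isEven n) ≡⟨ cong not (not-distribˡ-xor (isEven m) (isEven n)) ⟨
  not (not (isEven m xor isEven n)) ≡⟨ cong not (isEven-+ m n) ⟨
  not (isEven (m + n))              ∎
  where open ≡-Reasoning

isEven-+-notʳ : ∀ m n n′ → isEven n′ ≡ not (isEven n) → isEven (m + n′) ≡ not (isEven (m + n))
isEven-+-notʳ m n n′ e = begin
  isEven (m + n′)                   ≡⟨ isEven-+ m n′ ⟩
  not (isEven m xor isEven n′)      ≡⟨ cong (λ b → not (isEven m xor b)) e ⟩
  not (isEven m xor not (isEven n)) ≡⟨ cong not (not-distribʳ-xor (isEven m) (isEven n)) ⟨
  not (not (isEven m xor isEven n)) ≡⟨ cong not (isEven-+ m n) ⟨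
  not (isEven (m + n))              ∎
  where open ≡-Reasoning

isEven-bit+bit : ∀ b → isEven (bit b + bit b) ≡ true
isEven-bit+bit true  = refl
isEven-bit+bit false = refl

isEven-bit+bit-not : ∀ b → isEven (bit b + bit (not b)) ≡ false
isEven-bit+bit-not true  = refl
isEven-bit+bit-not false = refl

isEven-bit-not : ∀ b → isEven (bit (not b)) ≡ not (isEven (bit b))
isEven-bit-not true  = refl
isEven-bit-not false = refl

ℕ-<?-true : ∀ {a b} → a < b → does (a ℕ.<? b) ≡ true
ℕ-<?-true {a} {b} = dec-true (a ℕ.<? b)

ℕ-<?-false : ∀ {a b} → b ≤ a → does (a ℕ.<? b) ≡ false
ℕ-<?-false {a} {b} b≤a = dec-false (a ℕ.<? b) (ℕ.≤⇒≯ b≤a)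

ltB-abs< : ∀ x y → ∣ x ∣ < ∣ y ∣ → ltB x y ≡ ltB (+ 0) y × ltB y x ≡ ltB y (+ 0)
ltB-abs< (+ a)    (+ b)    a<b       = trans (ℕ-<?-true a<b) (sym (ℕ-<?-true (ℕ.≤-<-trans z≤n a<b)))
                                     , trans (ℕ-<?-false (ℕ.<⇒≤ a<b)) (sym (ℕ-<?-false {b} z≤n))
ltB-abs< (+ a)    -[1+ b ] _         = refl , refl
ltB-abs< -[1+ a ] (+ b)    a<b       = sym (ℕ-<?-true (ℕ.≤-<-trans z≤n a<b)) , refl
ltB-abs< -[1+ a ] -[1+ b ] (s≤s a<b) = ℕ-<?-false (ℕ.<⇒≤ a<b) , ℕ-<?-true a<b

∣neg∣< : ∀ x {n} → ∣ x ∣ < n → ∣ - x ∣ < n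
∣neg∣< x = subst (_< _) (sym (∣-i∣≡∣i∣ x))

<∣neg∣ : ∀ x {n} → n < ∣ x ∣ → n < ∣ - x ∣
<∣neg∣ x = subst (_ <_) (sym (∣-i∣≡∣i∣ x))

ltB-neg-abs< : ∀ z y → ∣ z ∣ < ∣ y ∣ → ltB y (- z) ≡ ltB y z × ltB (- z) y ≡ ltB z y
ltB-neg-abs< z y z<y with ltB-abs< z y z<y | ltB-abs< (- z) y (∣neg∣< z z<y)
... | z<y⇔0<y , y<z⇔y<0 | -z<y⇔0<y , y<-z⇔y<0 =
  trans y<-z⇔y<0 (sym y<z⇔y<0) , trans -z<y⇔0<y (sym z<y⇔0<y)

ltB-neg-0 : ∀ z → 0 < ∣ z ∣ → ltB (- z) (+ 0) ≡ not (ltB z (+ 0))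
ltB-neg-0 (+ suc _)  _ = refl
ltB-neg-0 -[1+ _ ]   _ = refl

ltB-0-neg : ∀ z → 0 < ∣ z ∣ → ltB (+ 0) (- z) ≡ not (ltB (+ 0) z)
ltB-0-neg (+ suc _)  _ = refl
ltB-0-neg -[1+ _ ]   _ = refl

pairInv : ℤ → ℤ → ℕ
pairInv x y = bit (ltB y x) + bit (ltB y (- x))

isEven-pairInv-abs< : ∀ x y → ∣ x ∣ < ∣ y ∣ → isEven (pairInv x y) ≡ true
isEven-pairInv-abs< x y x<y
  rewrite proj₂ (ltB-abs< x y x<y) | proj₂ (ltB-abs< (- x) y (∣neg∣< x x<y)) = isEven-bit+bit (ltB y (+ 0))

isEven-pairInv-abs> : ∀ x y → ∣ y ∣ < ∣ x ∣ → isEven (pairInv x y) ≡ false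
isEven-pairInv-abs> x y y<x
  rewrite proj₁ (ltB-abs< y x y<x) | proj₁ (ltB-abs< y (- x) (<∣neg∣ x y<x))
        | ltB-0-neg x (ℕ.≤-<-trans z≤n y<x) = isEven-bit+bit-not (ltB (+ 0) x)

isEven-pairInv-neg : ∀ x y → ∣ y ∣ ≢ ∣ x ∣ → isEven (pairInv x (- y)) ≡ isEven (pairInv x y)
isEven-pairInv-neg x y y≢x with ℕ.<-cmp ∣ y ∣ ∣ x ∣
... | tri< y<x _ _ = trans (isEven-pairInv-abs> x (- y) (∣neg∣< y y<x)) (sym (isEven-pairInv-abs> x y y<x))
... | tri≈ _ y≡x _ = contradiction y≡x y≢x
... | tri> _ _ x<y = trans (isEven-pairInv-abs< x (- y) (<∣neg∣ y x<y)) (sym (isEven-pairInv-abs< x y x<y))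

inversionsWith : ℤ → List ℤ → ℕ
inversionsWith x ys = countB (λ y → ltB y x) ys + countB (λ y → ltB y (- x)) ys

inversionsWith-∷ : ∀ x y ys → inversionsWith x (y ∷ ys) ≡ pairInv x y + inversionsWith x ys
inversionsWith-∷ x y ys = interchange (bit (ltB y x)) _ (bit (ltB y (- x))) _

inversionsWith-neg : ∀ x ys → inversionsWith (- x) ys ≡ inversionsWith x ys
inversionsWith-neg x ys rewrite neg-involutive x = ℕ.+-comm (countB (λ y → ltB y (- x)) ys) _

pairInversions : List ℤ → ℕ
pairInversions []       = 0
pairInversions (x ∷ xs) = inversionsWith x xs + pairInversions xs

invB≡pairInversions+neg : ∀ π → invB π ≡ pairInversions π + neg π
invB≡pairInversions+neg []       = refl
invB≡pairInversions+neg (x ∷ xs) =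
  trans (cong (_+_ (inversionsWith x xs + bit (ltB x (+ 0)))) (invB≡pairInversions+neg xs))
        (interchange (inversionsWith x xs) _ _ _)

negateAbs : ℕ → List ℤ → List ℤ
negateAbs m []       = []
negateAbs m (z ∷ zs) with ∣ z ∣ ℕ.≟ m
... | yes _ = - z ∷ zs
... | no  _ = z ∷ negateAbs m zs

negateAbs-there : ∀ {m z} zs → ∣ z ∣ ≢ m → negateAbs m (z ∷ zs) ≡ z ∷ negateAbs m zs
negateAbs-there {m} {z} zs z≢m with ∣ z ∣ ℕ.≟ m
... | yes z≡m = contradiction z≡m z≢m
... | no  _   = refl

map-abs-negateAbs : ∀ m zs → map ∣_∣ (negateAbs m zs) ≡ map ∣_∣ zs
map-abs-negateAbs m []       = refl
map-abs-negateAbs m (z ∷ zs) with ∣ z ∣ ℕ.≟ m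
... | yes _ = cong (_∷ map ∣_∣ zs) (∣-i∣≡∣i∣ z)
... | no  _ = cong (∣ z ∣ ∷_) (map-abs-negateAbs m zs)

negateAbs-involutive : ∀ m zs → negateAbs m (negateAbs m zs) ≡ zs
negateAbs-involutive m []       = refl
negateAbs-involutive m (z ∷ zs) with ∣ z ∣ ℕ.≟ m
... | no z≢m = trans (negateAbs-there (negateAbs m zs) z≢m) (cong (z ∷_) (negateAbs-involutive m zs))
... | yes z≡m with ∣ - z ∣ ℕ.≟ m
...   | yes _    = cong (_∷ zs) (neg-involutive z)
...   | no -z≢m  = contradiction (trans (∣-i∣≡∣i∣ z) z≡m) -z≢m

isEven-inversionsWith-negateAbs : ∀ {x m} zs → ∣ x ∣ ≢ m →
  isEven (inversionsWith x (negateAbs m zs)) ≡ isEven (inversionsWith x zs)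
isEven-inversionsWith-negateAbs []       _   = refl
isEven-inversionsWith-negateAbs {x} {m} (z ∷ zs) x≢m with ∣ z ∣ ℕ.≟ m
... | yes z≡m rewrite inversionsWith-∷ x (- z) zs | inversionsWith-∷ x z zs =
  isEven-+-congˡ (pairInv x (- z)) (pairInv x z) (inversionsWith x zs)
    (isEven-pairInv-neg x z (λ z≡x → x≢m (trans (sym z≡x) z≡m)))
... | no  _   rewrite inversionsWith-∷ x z (negateAbs m zs) | inversionsWith-∷ x z zs =
  isEven-+-congʳ (pairInv x z) (inversionsWith x (negateAbs m zs)) (inversionsWith x zs)
    (isEven-inversionsWith-negateAbs zs x≢m)

-- No hypothesis is needed: the entries preceding the negated one have absolute value other than m.
isEven-pairInversions-negateAbs : ∀ m π → isEven (pairInversions (negateAbs m π)) ≡ isEven (pairInversions π)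
isEven-pairInversions-negateAbs m []       = refl
isEven-pairInversions-negateAbs m (z ∷ zs) with ∣ z ∣ ℕ.≟ m
... | yes _   = cong (λ k → isEven (k + pairInversions zs)) (inversionsWith-neg z zs)
... | no  z≢m = trans
  (isEven-+-congˡ (inversionsWith z (negateAbs m zs)) (inversionsWith z zs) (pairInversions (negateAbs m zs))
    (isEven-inversionsWith-negateAbs zs z≢m))
  (isEven-+-congʳ (inversionsWith z zs) (pairInversions (negateAbs m zs)) (pairInversions zs)
    (isEven-pairInversions-negateAbs m zs))

isEven-neg-negateAbs : ∀ {m} π → 0 < m → m ∈ map ∣_∣ π → isEven (neg (negateAbs m π)) ≡ not (isEven (neg π))
isEven-neg-negateAbs {m} (z ∷ zs) 0<m m∈ with ∣ z ∣ ℕ.≟ m | m∈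
... | yes z≡m | _ = isEven-+-notˡ (bit (ltB z (+ 0))) (bit (ltB (- z) (+ 0))) (neg zs)
  (trans (cong (isEven ∘ bit) (ltB-neg-0 z (subst (0 <_) (sym z≡m) 0<m))) (isEven-bit-not (ltB z (+ 0))))
... | no z≢m | here m≡z  = contradiction (sym m≡z) z≢m
... | no _   | there m∈′ =
  isEven-+-notʳ (bit (ltB z (+ 0))) (neg zs) (neg (negateAbs m zs)) (isEven-neg-negateAbs zs 0<m m∈′)

isEven-invB-negateAbs : ∀ {m} π → 0 < m → m ∈ map ∣_∣ π → isEven (invB (negateAbs m π)) ≡ not (isEven (invB π))
isEven-invB-negateAbs {m} π 0<m m∈ rewrite invB≡pairInversions+neg (negateAbs m π) | invB≡pairInversions+neg π =
  trans (isEven-+-congˡ (pairInversions (negateAbs m π)) (pairInversions π) (neg (negateAbs m π))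
          (isEven-pairInversions-negateAbs m π))
        (isEven-+-notʳ (pairInversions π) (neg π) (neg (negateAbs m π)) (isEven-neg-negateAbs π 0<m m∈))

isEven-inversionsWith-abs< : ∀ {x} ys → All (∣ x ∣ <_) (map ∣_∣ ys) → isEven (inversionsWith x ys) ≡ true
isEven-inversionsWith-abs< []       []         = refl
isEven-inversionsWith-abs< {x} (y ∷ ys) (x<y ∷ x<ys) rewrite inversionsWith-∷ x y ys =
  trans (isEven-+-evenˡ (pairInv x y) _ (isEven-pairInv-abs< x y x<y)) (isEven-inversionsWith-abs< ys x<ys)

isEven-pairInversions-absIncreasing : ∀ π → AllPairs _<_ (map ∣_∣ π) → isEven (pairInversions π) ≡ true
isEven-pairInversions-absIncreasing []       []           = refl
isEven-pairInversions-absIncreasing (x ∷ xs) (x<xs ∷ inc) =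
  trans (isEven-+-evenˡ (inversionsWith x xs) _ (isEven-inversionsWith-abs< xs x<xs))
        (isEven-pairInversions-absIncreasing xs inc)

isEven-invB-absIncreasing : ∀ π → AllPairs _<_ (map ∣_∣ π) → isEven (invB π) ≡ isEven (neg π)
isEven-invB-absIncreasing π inc rewrite invB≡pairInversions+neg π =
  isEven-+-evenˡ (pairInversions π) (neg π) (isEven-pairInversions-absIncreasing π inc)

ι : List ℤ → List ℤ
ι []       = []
ι (x ∷ xs) with all? (∣ x ∣ ℕ.<?_) (map ∣_∣ xs)
... | yes _ = x ∷ ι xs
... | no  _ = x ∷ negateAbs (min ∣ x ∣ (map ∣_∣ xs)) xs

ι-∷-< : ∀ x ys → All (∣ x ∣ <_) (map ∣_∣ ys) → ι (x ∷ ys) ≡ x ∷ ι ys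
ι-∷-< x ys x<ys with all? (∣ x ∣ ℕ.<?_) (map ∣_∣ ys)
... | yes _   = refl
... | no  x≮ys = contradiction x<ys x≮ys

ι-∷-≮ : ∀ x ys → ¬ All (∣ x ∣ <_) (map ∣_∣ ys) → ι (x ∷ ys) ≡ x ∷ negateAbs (min ∣ x ∣ (map ∣_∣ ys)) ys
ι-∷-≮ x ys x≮ys with all? (∣ x ∣ ℕ.<?_) (map ∣_∣ ys)
... | yes x<ys = contradiction x<ys x≮ys
... | no  _    = refl

map-abs-ι : ∀ π → map ∣_∣ (ι π) ≡ map ∣_∣ π
map-abs-ι []       = refl
map-abs-ι (x ∷ xs) with all? (∣ x ∣ ℕ.<?_) (map ∣_∣ xs)
... | yes _ = cong (∣ x ∣ ∷_) (map-abs-ι xs)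
... | no  _ = cong (∣ x ∣ ∷_) (map-abs-negateAbs _ xs)

ι-involutive : ∀ π → ι (ι π) ≡ π
ι-involutive []       = refl
ι-involutive (x ∷ xs) with all? (∣ x ∣ ℕ.<?_) (map ∣_∣ xs)
... | yes x<xs = trans (ι-∷-< x (ι xs) (subst (All _) (sym (map-abs-ι xs)) x<xs)) (cong (x ∷_) (ι-involutive xs))
... | no  x≮xs = begin
  ι (x ∷ negateAbs m xs)
    ≡⟨ ι-∷-≮ x _ (x≮xs ∘ subst (All _) (map-abs-negateAbs m xs)) ⟩
  x ∷ negateAbs (min ∣ x ∣ (map ∣_∣ (negateAbs m xs))) (negateAbs m xs)
    ≡⟨ cong (λ as → x ∷ negateAbs (min ∣ x ∣ as) (negateAbs m xs)) (map-abs-negateAbs m xs) ⟩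
  x ∷ negateAbs m (negateAbs m xs)
    ≡⟨ cong (x ∷_) (negateAbs-involutive m xs) ⟩
  x ∷ xs
    ∎
  where
  open ≡-Reasoning
  m = min ∣ x ∣ (map ∣_∣ xs)

min-abs-descent : ∀ x xs → Unique (map ∣_∣ (x ∷ xs)) → ¬ All (∣ x ∣ <_) (map ∣_∣ xs) →
  (min ∣ x ∣ (map ∣_∣ xs) < ∣ x ∣) × (min ∣ x ∣ (map ∣_∣ xs) ∈ map ∣_∣ xs)
min-abs-descent x xs (x∉xs ∷ _) x≮xs with argmin-sel id ∣ x ∣ (map ∣_∣ xs)
... | inj₁ min≡x = contradiction x<xs x≮xs
  where
  x<xs = All.zipWith (λ (x≢y , min≤y) → ℕ.≤∧≢⇒< (subst (_≤ _) min≡x min≤y) x≢y) (x∉xs , min≤xs ∣ x ∣ (map ∣_∣ xs))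
... | inj₂ min∈ = ℕ.≤∧≢⇒< (min≤⊤ ∣ x ∣ (map ∣_∣ xs)) (All.lookup x∉xs min∈ ∘ sym) , min∈

data SameUpDown : List ℤ → List ℤ → Set where
  []     : SameUpDown [] []
  single : ∀ {a a′} → SameUpDown (a ∷ []) (a′ ∷ [])
  step   : ∀ {a a′ b b′ r r′} → ltB a b ≡ ltB a′ b′ → ltB b a ≡ ltB b′ a′ →
           SameUpDown (b ∷ r) (b′ ∷ r′) → SameUpDown (a ∷ b ∷ r) (a′ ∷ b′ ∷ r′)

SameUpDown-refl : ∀ s → SameUpDown s s
SameUpDown-refl []          = []
SameUpDown-refl (a ∷ [])    = single
SameUpDown-refl (a ∷ b ∷ r) = step refl refl (SameUpDown-refl (b ∷ r))

pkSeq-cong : ∀ {s s′} → SameUpDown s s′ → pkSeq s ≡ pkSeq s′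
pkSeq-cong []                                = refl
pkSeq-cong single                            = refl
pkSeq-cong (step _ _ single)                 = refl
pkSeq-cong (step a<b _ bc@(step _ c<b _))    = cong₂ _+_ (cong₂ (λ u v → if u then bit v else 0) a<b c<b) (pkSeq-cong bc)

valSeq-cong : ∀ {s s′} → SameUpDown s s′ → valSeq s ≡ valSeq s′
valSeq-cong []                               = refl
valSeq-cong single                           = refl
valSeq-cong (step _ _ single)                = refl
valSeq-cong (step _ b<a bc@(step b<c _ _))   = cong₂ _+_ (cong₂ (λ u v → if u then bit v else 0) b<a b<c) (valSeq-cong bc)

SameUpDown-negate-head : ∀ z zs → All (∣ z ∣ <_) (map ∣_∣ zs) → SameUpDown (z ∷ zs) (- z ∷ zs)
SameUpDown-negate-head z []       []          = single
SameUpDown-negate-head z (y ∷ ys) (z<y ∷ _) with ltB-neg-abs< z y z<y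
... | y<-z⇔y<z , -z<y⇔z<y = step (sym -z<y⇔z<y) (sym y<-z⇔y<z) (SameUpDown-refl (y ∷ ys))

-- Every entry before the one negated has absolute value above m, and so does every entry after it.
SameUpDown-negateAbs : ∀ {m} a w → m < ∣ a ∣ → All (m ≤_) (map ∣_∣ w) → Unique (map ∣_∣ w) →
  SameUpDown (a ∷ w) (a ∷ negateAbs m w)
SameUpDown-negateAbs     a []       _   _             _           = single
SameUpDown-negateAbs {m} a (z ∷ zs) m<a (m≤z ∷ m≤zs) (z∉zs ∷ uniq) with ∣ z ∣ ℕ.≟ m
... | yes z≡m with ltB-neg-abs< z a (subst (_< ∣ a ∣) (sym z≡m) m<a)
...   | a<-z⇔a<z , -z<a⇔z<a =
  step (sym a<-z⇔a<z) (sym -z<a⇔z<a) (SameUpDown-negate-head z zs z<zs)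
  where
  z<zs = All.zipWith (λ (z≢y , m≤y) → ℕ.≤∧≢⇒< (subst (_≤ _) (sym z≡m) m≤y) z≢y) (z∉zs , m≤zs)
SameUpDown-negateAbs a (z ∷ zs) m<a (m≤z ∷ m≤zs) (z∉zs ∷ uniq) | no z≢m =
  step refl refl (SameUpDown-negateAbs z zs (ℕ.≤∧≢⇒< m≤z (z≢m ∘ sym)) m≤zs uniq)

SameUpDown-ι : ∀ a π → Unique (map ∣_∣ π) → SameUpDown (a ∷ π) (a ∷ ι π)
SameUpDown-ι a []       _                    = single
SameUpDown-ι a (x ∷ xs) uniq@(_ ∷ uniq-xs) with all? (∣ x ∣ ℕ.<?_) (map ∣_∣ xs)
... | yes _    = step refl refl (SameUpDown-ι x xs uniq-xs)
... | no  x≮xs = step refl refl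
  (SameUpDown-negateAbs x xs (proj₁ (min-abs-descent x xs uniq x≮xs)) (min≤xs ∣ x ∣ (map ∣_∣ xs)) uniq-xs)

altrunsB-ι : ∀ π → Unique (map ∣_∣ π) → altrunsB (ι π) ≡ altrunsB π
altrunsB-ι π uniq = sym (cong₂ (λ p v → p + v + 1) (pkSeq-cong same) (valSeq-cong same))
  where same = SameUpDown-ι (+ 0) π uniq

ι-absIncreasing-or-negateAbs : ∀ π → Unique (map ∣_∣ π) → All (λ y → 0 < ∣ y ∣) π →
  AllPairs _<_ (map ∣_∣ π) ⊎ ∃[ m ] (0 < m × m ∈ map ∣_∣ π × ι π ≡ negateAbs m π)
ι-absIncreasing-or-negateAbs []       _                       _          = inj₁ []
ι-absIncreasing-or-negateAbs (x ∷ xs) uniq@(_ ∷ uniq-xs) (_ ∷ nonzero) with all? (∣ x ∣ ℕ.<?_) (map ∣_∣ xs)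
... | no x≮xs =
  inj₂ (m , All.lookup (All.map⁺ {P = 0 <_} nonzero) m∈ , there m∈ , sym (negateAbs-there xs (ℕ.<⇒≢ m<x ∘ sym)))
  where
  m = min ∣ x ∣ (map ∣_∣ xs)
  m<x = proj₁ (min-abs-descent x xs uniq x≮xs)
  m∈  = proj₂ (min-abs-descent x xs uniq x≮xs)
... | yes x<xs with ι-absIncreasing-or-negateAbs xs uniq-xs nonzero
...   | inj₁ increasing           = inj₁ (x<xs ∷ increasing)
...   | inj₂ (m , 0<m , m∈ , ιxs) =
  inj₂ (m , 0<m , there m∈ , trans (cong (x ∷_) ιxs) (sym (negateAbs-there xs (ℕ.<⇒≢ (All.lookup x<xs m∈)))))

ι-parity : ∀ π → Unique (map ∣_∣ π) → All (λ y → 0 < ∣ y ∣) π →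
  isEven (invB π) ≡ isEven (neg π)
  ⊎ (isEven (invB (ι π)) ≡ not (isEven (invB π)) × isEven (neg (ι π)) ≡ not (isEven (neg π)))
ι-parity π uniq nonzero with ι-absIncreasing-or-negateAbs π uniq nonzero
... | inj₁ increasing          = inj₁ (isEven-invB-absIncreasing π increasing)
... | inj₂ (m , 0<m , m∈ , ιπ) rewrite ιπ =
  inj₂ (isEven-invB-negateAbs π 0<m m∈ , isEven-neg-negateAbs π 0<m m∈)

concatMap-map≡cartesianProductWith : {A B C : Set} (f : A → B → C) (xs : List A) (ys : List B) →
  concatMap (λ x → map (f x) ys) xs ≡ cartesianProductWith f xs ys
concatMap-map≡cartesianProductWith f []       ys = refl
concatMap-map≡cartesianProductWith f (x ∷ xs) ys = cong (map (f x) ys ++_) (concatMap-map≡cartesianProductWith f xs ys)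

words-suc : {A : Set} (S : List A) (k : ℕ) → words S (suc k) ≡ cartesianProductWith _∷_ S (words S k)
words-suc S k = concatMap-map≡cartesianProductWith _∷_ S (words S k)

words-unique : {A : Set} {S : List A} → Unique S → ∀ k → Unique (words S k)
words-unique uniq zero    = [] ∷ []
words-unique {S = S} uniq (suc k) rewrite words-suc S k =
  Unique.cartesianProductWith⁺ _∷_ ∷-injective uniq (words-unique uniq k)

∈-words⁻ : {A : Set} {S : List A} (k : ℕ) {π : List A} → π ∈ words S k → All (_∈ S) π
∈-words⁻ zero (here refl) = []
∈-words⁻ {S = S} (suc k) π∈ rewrite words-suc S k with ∈-cartesianProductWith⁻ _∷_ S (words S k) π∈
... | _ , _ , y∈ , w∈ , refl = y∈ ∷ ∈-words⁻ k w∈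

∈-words-resp : {A : Set} {R : A → A → Set} {S : List A} → (∀ {y y′} → R y y′ → y ∈ S → y′ ∈ S) →
  ∀ k {π π′} → Pointwise R π π′ → π ∈ words S k → π′ ∈ words S k
∈-words-resp resp zero [] (here refl) = here refl
∈-words-resp {S = S} resp (suc k) rs π∈ rewrite words-suc S k with ∈-cartesianProductWith⁻ _∷_ S (words S k) π∈
∈-words-resp resp (suc k) (r ∷ rs) π∈ | _ , _ , y∈ , w∈ , refl =
  ∈-cartesianProductWith⁺ _∷_ (resp r y∈) (∈-words-resp resp k rs w∈)

signedPair : ℕ → List ℤ
signedPair i = + suc i ∷ - (+ suc i) ∷ []

∈-signedPair⁻ : ∀ {i z} → z ∈ signedPair i → ∣ z ∣ ≡ suc i
∈-signedPair⁻ (here refl)         = refl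
∈-signedPair⁻ (there (here refl)) = refl

∈-signedPair⁺ : ∀ {i} z → ∣ z ∣ ≡ suc i → z ∈ signedPair i
∈-signedPair⁺ (+ _)    refl = here refl
∈-signedPair⁺ -[1+ _ ] refl = there (here refl)

signedEntries-unique : ∀ n → Unique (signedEntries n)
signedEntries-unique n = Unique.concat⁺
  (All.map⁺ (All.universal (λ _ → ((λ ()) ∷ []) ∷ [] ∷ []) (upTo n)))
  (AllPairs.map⁺ (AllPairs.map disjoint (Unique.upTo⁺ n)))
  where
  disjoint : ∀ {i j} → i ≢ j → Disjoint (signedPair i) (signedPair j)
  disjoint i≢j (z∈i , z∈j) = i≢j (ℕ.suc-injective (trans (sym (∈-signedPair⁻ z∈i)) (∈-signedPair⁻ z∈j)))

signedEntries-nonzero : ∀ {n z} → z ∈ signedEntries n → 0 < ∣ z ∣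
signedEntries-nonzero {n} z∈ with find (∈-concatMap⁻ signedPair {xs = upTo n} z∈)
... | _ , _ , z∈pair = subst (0 <_) (sym (∈-signedPair⁻ z∈pair)) (s≤s z≤n)

signedEntries-resp-abs : ∀ {n z z′} → ∣ z ∣ ≡ ∣ z′ ∣ → z ∈ signedEntries n → z′ ∈ signedEntries n
signedEntries-resp-abs {n} {z′ = z′} z≡z′ z∈ with find (∈-concatMap⁻ signedPair {xs = upTo n} z∈)
... | i , i∈ , z∈pair =
  ∈-concatMap⁺ signedPair (Any.map (λ { refl → ∈-signedPair⁺ z′ (trans (sym z≡z′) (∈-signedPair⁻ z∈pair)) }) i∈)

B-unique : ∀ n → Unique (B n)
B-unique n = Unique.filter⁺ _ (words-unique (signedEntries-unique n) n)

∈-B⁻ : ∀ n {π} → π ∈ B n → Unique (map ∣_∣ π) × All (λ y → 0 < ∣ y ∣) π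
∈-B⁻ n π∈ with ∈-filter⁻ _ {xs = words (signedEntries n) n} π∈
... | π∈words , uniq = uniq , All.map (signedEntries-nonzero {n}) (∈-words⁻ n π∈words)

∈-B-resp-abs : ∀ n {π π′} → map ∣_∣ π ≡ map ∣_∣ π′ → π ∈ B n → π′ ∈ B n
∈-B-resp-abs n eq π∈ with ∈-filter⁻ _ {xs = words (signedEntries n) n} π∈
... | π∈words , uniq = ∈-filter⁺ _
  (∈-words-resp (signedEntries-resp-abs {n}) n (Pointwise.map⁻ ∣_∣ ∣_∣ (Pointwise.≡⇒Pointwise-≡ eq)) π∈words)
  (subst Unique eq uniq)

ι-involutionOn-B : ∀ n → InvolutionOn ι (B n)
ι-involutionOn-B n = record
  { closed     = λ {π} π∈ → ∈-B-resp-abs n (sym (map-abs-ι π)) π∈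
  ; involutive = λ {π} _ → ι-involutive π
  }

coeffR-filter-invB≡neg : ∀ n k b →
  coeffR (filter (λ π → isEven (invB π) Bool.≟ b) (B n)) k ≡ coeffR (filter (λ π → isEven (neg π) Bool.≟ b) (B n)) k
coeffR-filter-invB≡neg n k b = begin
  coeffR (filter (λ π → isEven (invB π) Bool.≟ b) (B n)) k  ≡⟨ countB-filter _ _ (B n) ⟩
  countB (λ π → h (isEven (invB π)) (altrunsB π)) (B n)     ≡⟨ exchange ⟩
  countB (λ π → h (isEven (neg π)) (altrunsB π)) (B n)      ≡⟨ countB-filter _ _ (B n) ⟨
  coeffR (filter (λ π → isEven (neg π) Bool.≟ b) (B n)) k   ∎
  where
  open ≡-Reasoning
  h : Bool → ℕ → Bool
  h p a = does (p Bool.≟ b) ∧ does (a ℕ.≟ k)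
  exchange : countB (λ π → h (isEven (invB π)) (altrunsB π)) (B n) ≡ countB (λ π → h (isEven (neg π)) (altrunsB π)) (B n)
  exchange = countB-exchange (isEven ∘ invB) (isEven ∘ neg) altrunsB (B-unique n) (ι-involutionOn-B n)
    (λ π∈ → altrunsB-ι _ (proj₁ (∈-B⁻ n π∈)))
    (λ π∈ → ι-parity _ (proj₁ (∈-B⁻ n π∈)) (proj₂ (∈-B⁻ n π∈)))
    h

theorem53 : (n : ℕ) → 1 ≤ n → (k : ℕ) →
    (coeffR (Bplus n) k ≡ coeffR (D n) k) × (coeffR (Bminus n) k ≡ coeffR (BminusD n) k)
theorem53 n _ k = coeffR-filter-invB≡neg n k true , coeffR-filter-invB≡neg n k false
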